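{- Let $p$ be a prime and let $\pounds_0(X)=\sum_{k=1}^{p-1}X^k\in\mathbb{F}_p[X]$. For every power series $g(X)\in\mathbb{F}_p[[X]]$ with constant term $1$, we have \[ \pounds_0(g(X))\equiv\begin{cases}X^{p-1}-1 \pmod{X^p} & \text{if } g'(0)\neq 0,\\ -1 \pmod{X^{2p-2}} & \text{if } g'(0)=0,\end{cases} \] where $g'$ denotes the formal derivative of $g$ and congruences are in $\mathbb{F}_p[[X]]$.
   Context: $\pounds_0(X)=\sum_{k=1}^{p-1}X^k$ is the finite polylogarithm of order $0$ (depending on the prime $p$). -}

module Defs where

open import Data.Nat as ℕ using (ℕ; zero; suc; _∸_; _≡ᵇ_)
open import Data.Integer using (ℤ; +_; _+_; _*_; _-_; -_)
open import Data.Integer.Divisibility using (_∣_)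
open import Data.Bool using (if_then_else_)

-- Power series with integer coefficients; F_p[[X]] is modelled as Z[[X]]
-- with coefficients compared modulo p (reduction Z → F_p is a ring hom).
Series : Set
Series = ℕ → ℤ

_≡_[mod_] : ℤ → ℤ → ℕ → Set
a ≡ b [mod p ] = (+ p) ∣ (a - b)

sumTo : (ℕ → ℤ) → ℕ → ℤ
sumTo h zero    = + 0
sumTo h (suc n) = sumTo h n + h n

oneS : Series
oneS n = if n ≡ᵇ 0 then + 1 else + 0

_*S_ : Series → Series → Series
(f *S g) n = sumTo (λ i → f i * g (n ∸ i)) (suc n)

powS : Series → ℕ → Series
powS f zero    = oneS
powS f (suc k) = f *S powS f k

£₀ : ℕ → Series → Series
£₀ p g n = sumTo (λ k → powS g (suc k) n) (p ∸ 1)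

XpowMinusOne : ℕ → Series
XpowMinusOne p n = (if n ≡ᵇ (p ∸ 1) then + 1 else + 0) - oneS n

minusOne : Series
minusOne n = - oneS n

_≡_[modp_,X^_] : Series → Series → ℕ → ℕ → Set
f ≡ h [modp p ,X^ N ] = ∀ n → n ℕ.< N → f n ≡ h n [mod p ]

-- Write g = 1 + h. The binomial theorem and the hockey-stick identity
-- Σ_{k≤m} C(k,j) = C(m+1,j+1) give £₀(g) + 1 = Σ_{j<p} C(p,j+1) h^j, and modulo p only
-- the term j = p-1 survives, so £₀(g) ≡ h^(p-1) - 1. As g(0) = 1, X divides h. If
-- h'(0) = g'(0) is a unit, then h^(p-1) ≡ g'(0)^(p-1) X^(p-1) ≡ X^(p-1) mod X^p by Fermat's
-- little theorem (itself a consequence of (1 + x)^p ≡ 1 + x^p); if g'(0) = 0, then X^2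
-- divides h and hence X^(2p-2) divides h^(p-1).

module Submission where

open import Defs
open import Data.Nat as ℕ using (ℕ; zero; suc; _∸_; _<_; _≤_; z≤n; s≤s; _<?_; _!; _≡ᵇ_)
import Data.Nat.Properties as ℕP
open import Data.Nat.Combinatorics
  using (_C_; nCn≡1; k>n⇒nCk≡0; nCk≡n!/k![n-k]!; k![n∸k]!∣n!; nCk+nC[k+1]≡[n+1]C[k+1])
open import Data.Nat.DivMod using (m/n*n≡m)
open import Data.Nat.Divisibility as ℕ∣ using (∣⇒≤)
open import Data.Nat.Primality using (Prime; euclidsLemma; ¬prime[0]; ¬prime[1])
open import Data.Integer as ℤ using (ℤ; +_; -[1+_]; 0ℤ; 1ℤ; _+_; _*_; _-_; -_; _^_)
import Data.Integer.Properties as ℤP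
import Data.Integer.Divisibility.Signed as ℤ∣
open import Data.Integer.Tactic.RingSolver using (solve-∀)
open import Data.Bool using (true; false; T; if_then_else_)
open import Data.Unit using (tt)
open import Function using (_∘_; flip)
open import Data.Sum using (_⊎_; inj₁; inj₂; [_,_])
open import Data.Product using (_×_; _,_)
open import Relation.Nullary using (¬_; yes; no; contradiction)
open import Relation.Binary.Bundles using (Setoid)
open import Relation.Binary.PropositionalEquality
  using (_≡_; _≢_; refl; sym; trans; cong; cong₂; subst; module ≡-Reasoning)
import Relation.Binary.Reasoning.Setoid

sumTo-cong : ∀ {f g : ℕ → ℤ} n → (∀ i → i < n → f i ≡ g i) → sumTo f n ≡ sumTo g n
sumTo-cong zero    f≡g = refl
sumTo-cong (suc n) f≡g =
  cong₂ _+_ (sumTo-cong n (λ i i<n → f≡g i (ℕP.m<n⇒m<1+n i<n))) (f≡g n ℕP.≤-refl)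

sumTo-zero : ∀ n → sumTo (λ _ → 0ℤ) n ≡ 0ℤ
sumTo-zero zero    = refl
sumTo-zero (suc n) = cong (_+ 0ℤ) (sumTo-zero n)

sumTo-distrib-+ : ∀ (f g : ℕ → ℤ) n → sumTo (λ i → f i + g i) n ≡ sumTo f n + sumTo g n
sumTo-distrib-+ f g zero    = refl
sumTo-distrib-+ f g (suc n) =
  trans (cong (_+ (f n + g n)) (sumTo-distrib-+ f g n)) (shuffle (sumTo f n) (sumTo g n) (f n) (g n))
  where
  shuffle : ∀ a b c d → (a + b) + (c + d) ≡ (a + c) + (b + d)
  shuffle = solve-∀

*-distribˡ-sumTo : ∀ c (f : ℕ → ℤ) n → c * sumTo f n ≡ sumTo (λ i → c * f i) n
*-distribˡ-sumTo c f zero    = ℤP.*-zeroʳ c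
*-distribˡ-sumTo c f (suc n) =
  trans (ℤP.*-distribˡ-+ c (sumTo f n) (f n)) (cong (_+ c * f n) (*-distribˡ-sumTo c f n))

*-distribʳ-sumTo : ∀ c (f : ℕ → ℤ) n → sumTo f n * c ≡ sumTo (λ i → f i * c) n
*-distribʳ-sumTo c f n =
  trans (ℤP.*-comm (sumTo f n) c)
    (trans (*-distribˡ-sumTo c f n) (sumTo-cong n (λ i _ → ℤP.*-comm c (f i))))

sumTo-unfoldˡ : ∀ (f : ℕ → ℤ) n → sumTo f (suc n) ≡ f 0 + sumTo (λ i → f (suc i)) n
sumTo-unfoldˡ f zero    = ℤP.+-comm 0ℤ (f 0)
sumTo-unfoldˡ f (suc n) = trans (cong (_+ f (suc n)) (sumTo-unfoldˡ f n)) (ℤP.+-assoc (f 0) _ _)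

sumTo-comm : ∀ (F : ℕ → ℕ → ℤ) m n →
  sumTo (λ i → sumTo (λ j → F i j) n) m ≡ sumTo (λ j → sumTo (λ i → F i j) m) n
sumTo-comm F zero    n = sym (sumTo-zero n)
sumTo-comm F (suc m) n =
  trans (cong (_+ sumTo (F m) n) (sumTo-comm F m n))
        (sym (sumTo-distrib-+ (λ j → sumTo (λ i → F i j) m) (F m) n))

*S-identityˡ : ∀ f n → (oneS *S f) n ≡ f n
*S-identityˡ f n = begin
  sumTo (λ i → oneS i * f (n ∸ i)) (suc n)
    ≡⟨ sumTo-unfoldˡ (λ i → oneS i * f (n ∸ i)) n ⟩
  1ℤ * f n + sumTo (λ i → 0ℤ * f (n ∸ suc i)) n
    ≡⟨ cong₂ _+_ (ℤP.*-identityˡ (f n)) (sumTo-cong n (λ i _ → ℤP.*-zeroˡ (f (n ∸ suc i)))) ⟩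
  f n + sumTo (λ _ → 0ℤ) n
    ≡⟨ trans (cong (_+_ (f n)) (sumTo-zero n)) (ℤP.+-identityʳ (f n)) ⟩
  f n
    ∎
  where open ≡-Reasoning

*S-congˡ : ∀ {f f′} g n → (∀ i → f i ≡ f′ i) → (f *S g) n ≡ (f′ *S g) n
*S-congˡ g n f≡f′ = sumTo-cong (suc n) (λ i _ → cong (_* g (n ∸ i)) (f≡f′ i))

*S-congʳ : ∀ {g g′} f n → (∀ i → g i ≡ g′ i) → (f *S g) n ≡ (f *S g′) n
*S-congʳ f n g≡g′ = sumTo-cong (suc n) (λ i _ → cong (f i *_) (g≡g′ (n ∸ i)))

*S-distribʳ-+ : ∀ f f′ g n → ((λ i → f i + f′ i) *S g) n ≡ (f *S g) n + (f′ *S g) n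
*S-distribʳ-+ f f′ g n =
  trans (sumTo-cong (suc n) (λ i _ → ℤP.*-distribʳ-+ (g (n ∸ i)) (f i) (f′ i)))
        (sumTo-distrib-+ _ _ (suc n))

*S-distribˡ-sumTo : ∀ f (c : ℕ → ℤ) (G : ℕ → Series) m n →
  (f *S (λ k → sumTo (λ j → c j * G j k) m)) n ≡ sumTo (λ j → c j * (f *S G j) n) m
*S-distribˡ-sumTo f c G m n = begin
  sumTo (λ i → f i * sumTo (λ j → c j * G j (n ∸ i)) m) (suc n)
    ≡⟨ sumTo-cong (suc n) (λ i _ → *-distribˡ-sumTo (f i) _ m) ⟩
  sumTo (λ i → sumTo (λ j → f i * (c j * G j (n ∸ i))) m) (suc n)
    ≡⟨ sumTo-comm (λ i j → f i * (c j * G j (n ∸ i))) (suc n) m ⟩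
  sumTo (λ j → sumTo (λ i → f i * (c j * G j (n ∸ i))) (suc n)) m
    ≡⟨ sumTo-cong m (λ j _ → sumTo-cong (suc n) (λ i _ → swap (f i) (c j) (G j (n ∸ i)))) ⟩
  sumTo (λ j → sumTo (λ i → c j * (f i * G j (n ∸ i))) (suc n)) m
    ≡⟨ sumTo-cong m (λ j _ → sym (*-distribˡ-sumTo (c j) _ (suc n))) ⟩
  sumTo (λ j → c j * (f *S G j) n) m
    ∎
  where
  open ≡-Reasoning
  swap : ∀ a b c → a * (b * c) ≡ b * (a * c)
  swap = solve-∀

powS-coeff₀ : ∀ f k → powS f k 0 ≡ f 0 ^ k
powS-coeff₀ f zero    = refl
powS-coeff₀ f (suc k) = trans (ℤP.+-identityˡ _) (cong (f 0 *_) (powS-coeff₀ f k))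

pascal-sumTo : ∀ (P : ℕ → ℤ) {k m} → k < m →
  sumTo (λ j → + (k C j) * P j) (suc m) + sumTo (λ j → + (k C j) * P (suc j)) (suc m)
    ≡ sumTo (λ j → + (suc k C j) * P j) (suc m)
pascal-sumTo P {k} {m} k<m = begin
  sumTo (λ j → + (k C j) * P j) (suc m) + (B + + (k C m) * P (suc m))
    ≡⟨ cong₂ _+_ (sumTo-unfoldˡ (λ j → + (k C j) * P j) m)
                 (cong (λ c → B + + c * P (suc m)) (k>n⇒nCk≡0 k<m)) ⟩
  (1ℤ * P 0 + A) + (B + 0ℤ * P (suc m))
    ≡⟨ regroup (P 0) A B (P (suc m)) ⟩
  1ℤ * P 0 + (B + A)
    ≡⟨ cong (_+_ (1ℤ * P 0)) (sym (sumTo-distrib-+ _ _ m)) ⟩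
  1ℤ * P 0 + sumTo (λ j → + (k C j) * P (suc j) + + (k C suc j) * P (suc j)) m
    ≡⟨ cong (_+_ (1ℤ * P 0)) (sumTo-cong m (λ j _ → pascal j)) ⟩
  1ℤ * P 0 + sumTo (λ j → + (suc k C suc j) * P (suc j)) m
    ≡⟨ sym (sumTo-unfoldˡ (λ j → + (suc k C j) * P j) m) ⟩
  sumTo (λ j → + (suc k C j) * P j) (suc m)
    ∎
  where
  open ≡-Reasoning
  A = sumTo (λ j → + (k C suc j) * P (suc j)) m
  B = sumTo (λ j → + (k C j) * P (suc j)) m
  regroup : ∀ a x y b → (1ℤ * a + x) + (y + 0ℤ * b) ≡ 1ℤ * a + (y + x)
  regroup = solve-∀
  pascal : ∀ j → + (k C j) * P (suc j) + + (k C suc j) * P (suc j) ≡ + (suc k C suc j) * P (suc j)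
  pascal j = trans (sym (ℤP.*-distribʳ-+ (P (suc j)) (+ (k C j)) (+ (k C suc j))))
                   (cong (λ c → + c * P (suc j)) (nCk+nC[k+1]≡[n+1]C[k+1] k j))

binomial : ∀ {f h} → (∀ i → f i ≡ oneS i + h i) → ∀ {k m} → k < m → ∀ n →
  powS f k n ≡ sumTo (λ j → + (k C j) * powS h j n) m
binomial {h = h} f≡1+h {zero} {suc m} _ n = sym (begin
  sumTo (λ j → + (0 C j) * powS h j n) (suc m)
    ≡⟨ sumTo-unfoldˡ (λ j → + (0 C j) * powS h j n) m ⟩
  1ℤ * oneS n + sumTo (λ j → 0ℤ * powS h (suc j) n) m
    ≡⟨ cong₂ _+_ (ℤP.*-identityˡ (oneS n)) (sumTo-cong m (λ j _ → ℤP.*-zeroˡ (powS h (suc j) n))) ⟩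
  oneS n + sumTo (λ _ → 0ℤ) m
    ≡⟨ trans (cong (_+_ (oneS n)) (sumTo-zero m)) (ℤP.+-identityʳ (oneS n)) ⟩
  oneS n
    ∎)
  where open ≡-Reasoning
binomial {f} {h} f≡1+h {suc k} {suc m} (s≤s k<m) n = begin
  (f *S powS f k) n
    ≡⟨ *S-congʳ f n (binomial f≡1+h (ℕP.m<n⇒m<1+n k<m)) ⟩
  (f *S R) n
    ≡⟨ *S-congˡ R n f≡1+h ⟩
  ((λ i → oneS i + h i) *S R) n
    ≡⟨ *S-distribʳ-+ oneS h R n ⟩
  (oneS *S R) n + (h *S R) n
    ≡⟨ cong₂ _+_ (*S-identityˡ R n) (*S-distribˡ-sumTo h (λ j → + (k C j)) (powS h) (suc m) n) ⟩
  R n + sumTo (λ j → + (k C j) * powS h (suc j) n) (suc m)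
    ≡⟨ pascal-sumTo (λ j → powS h j n) k<m ⟩
  sumTo (λ j → + (suc k C j) * powS h j n) (suc m)
    ∎
  where
  open ≡-Reasoning
  R : Series
  R i = sumTo (λ j → + (k C j) * powS h j i) (suc m)

hockey-stick : ∀ m j → sumTo (λ k → + (k C j)) (suc m) ≡ + (suc m C suc j)
hockey-stick zero    zero    = refl
hockey-stick zero    (suc j) = refl
hockey-stick (suc m) j       =
  trans (cong (_+ + (suc m C j)) (hockey-stick m j))
        (cong +_ (trans (ℕP.+-comm (suc m C suc j) (suc m C j)) (nCk+nC[k+1]≡[n+1]C[k+1] (suc m) j)))

_-1S : Series → Series
(g -1S) i = g i - oneS i

sumTo-powS-binomial : ∀ g m n →
  sumTo (λ k → powS g (suc k) n) m + oneS n
    ≡ sumTo (λ j → + (suc m C suc j) * powS (g -1S) j n) (suc m)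
sumTo-powS-binomial g m n = begin
  sumTo (λ k → powS g (suc k) n) m + oneS n
    ≡⟨ trans (ℤP.+-comm _ (oneS n)) (sym (sumTo-unfoldˡ (λ k → powS g k n) m)) ⟩
  sumTo (λ k → powS g k n) (suc m)
    ≡⟨ sumTo-cong (suc m) (λ k k<1+m → binomial g≡1+h k<1+m n) ⟩
  sumTo (λ k → sumTo (λ j → + (k C j) * h^ j) (suc m)) (suc m)
    ≡⟨ sumTo-comm (λ k j → + (k C j) * h^ j) (suc m) (suc m) ⟩
  sumTo (λ j → sumTo (λ k → + (k C j) * h^ j) (suc m)) (suc m)
    ≡⟨ sumTo-cong (suc m) (λ j _ → sym (*-distribʳ-sumTo (h^ j) (λ k → + (k C j)) (suc m))) ⟩
  sumTo (λ j → sumTo (λ k → + (k C j)) (suc m) * h^ j) (suc m)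
    ≡⟨ sumTo-cong (suc m) (λ j _ → cong (_* h^ j) (hockey-stick m j)) ⟩
  sumTo (λ j → + (suc m C suc j) * h^ j) (suc m)
    ∎
  where
  open ≡-Reasoning
  h^ : ℕ → ℤ
  h^ j = powS (g -1S) j n
  g≡1+h : ∀ i → g i ≡ oneS i + (g -1S) i
  g≡1+h i = a≡b+[a-b] (g i) (oneS i)
    where
    a≡b+[a-b] : ∀ a b → a ≡ b + (a - b)
    a≡b+[a-b] = solve-∀

-- binomial applied to the constant series x * oneS, read off at coefficient 0.
binomial-ℤ : ∀ x k → (1ℤ + x) ^ k ≡ sumTo (λ j → + (k C j) * x ^ j) (suc k)
binomial-ℤ x k = begin
  (1ℤ + x) ^ k
    ≡⟨ cong (λ y → (1ℤ + y) ^ k) (sym (ℤP.*-identityʳ x)) ⟩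
  (1ℤ + x * 1ℤ) ^ k
    ≡⟨ sym (powS-coeff₀ (λ i → oneS i + x * oneS i) k) ⟩
  powS (λ i → oneS i + x * oneS i) k 0
    ≡⟨ binomial {h = λ i → x * oneS i} (λ _ → refl) (ℕP.n<1+n k) 0 ⟩
  sumTo (λ j → + (k C j) * powS (λ i → x * oneS i) j 0) (suc k)
    ≡⟨ sumTo-cong (suc k) (λ j _ → cong (+ (k C j) *_) (powS-coeff₀-x j)) ⟩
  sumTo (λ j → + (k C j) * x ^ j) (suc k)
    ∎
  where
  open ≡-Reasoning
  powS-coeff₀-x : ∀ j → powS (λ i → x * oneS i) j 0 ≡ x ^ j
  powS-coeff₀-x j = trans (powS-coeff₀ _ j) (cong (_^ j) (ℤP.*-identityʳ x))

nCk*[k!*[n∸k]!]≡n! : ∀ {n k} → k ≤ n → (n C k) ℕ.* (k ! ℕ.* (n ∸ k) !) ≡ n !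
nCk*[k!*[n∸k]!]≡n! {n} {k} k≤n =
  trans (cong (ℕ._* (k ! ℕ.* (n ∸ k) !)) (nCk≡n!/k![n-k]! k≤n)) (m/n*n≡m (k![n∸k]!∣n! k≤n))
  where instance _ = k ℕP.!* (n ∸ k) !≢0

prime∤! : ∀ {p m} → Prime p → m < p → ¬ p ℕ∣.∣ m !
prime∤! {m = zero}  pr _   p∣1 = ¬prime[1] (subst Prime (ℕ∣.∣1⇒≡1 p∣1) pr)
prime∤! {m = suc m} pr m<p p∣m! with euclidsLemma (suc m) (m !) pr p∣m!
... | inj₁ p∣1+m = ℕP.<⇒≱ m<p (∣⇒≤ p∣1+m)
... | inj₂ p∣m!  = prime∤! pr (ℕP.<-trans (ℕP.n<1+n m) m<p) p∣m!

prime∣pCk : ∀ {p k} → Prime p → 0 < k → k < p → p ℕ∣.∣ p C k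
prime∣pCk {suc q} {suc k} pr _ k<p
  with euclidsLemma (suc q C suc k) _ pr
         (subst (suc q ℕ∣.∣_) (sym (nCk*[k!*[n∸k]!]≡n! (ℕP.<⇒≤ k<p))) (ℕ∣.m∣m*n (q !)))
... | inj₁ p∣C = p∣C
... | inj₂ p∣k![p∸k]! with euclidsLemma (suc k !) _ pr p∣k![p∸k]!
...   | inj₁ p∣k!     = contradiction p∣k! (prime∤! pr k<p)
...   | inj₂ p∣[p∸k]! = contradiction p∣[p∸k]! (prime∤! pr (s≤s (ℕP.m∸n≤m q k)))

∸-<-of-+ : ∀ {n a b i} → n < a ℕ.+ b → a ≤ i → i ≤ n → n ∸ i < b
∸-<-of-+ {n}     {zero}  {i = i}     n<b         _         _         = ℕP.≤-<-trans (ℕP.m∸n≤m n i) n<b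
∸-<-of-+ {suc n} {suc a} {i = suc i} (s≤s n<a+b) (s≤s a≤i) (s≤s i≤n) = ∸-<-of-+ n<a+b a≤i i≤n

module Congruence (p : ℕ) where

  -- A record rather than a synonym of _≡_[mod p ], so that both sides can be inferred.
  infix 4 _≈_
  record _≈_ (a b : ℤ) : Set where
    constructor mod
    field unmod : a ≡ b [mod p ]

  open _≈_ public

  private
    divides-via : ∀ {x a b} → x ≡ a - b → + p ℤ∣.∣ x → a ≈ b
    divides-via refl x = mod (ℤ∣.∣⇒∣ᵤ x)

    divides : ∀ {a b} → a ≈ b → + p ℤ∣.∣ (a - b)
    divides (mod a≡b) = ℤ∣.∣ᵤ⇒∣ a≡b

  ≈-reflexive : ∀ {a b} → a ≡ b → a ≈ b
  ≈-reflexive {a} refl = divides-via (sym (ℤP.+-inverseʳ a)) (ℤ∣.∣ᵤ⇒∣ (p ℕ∣.∣0))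

  ≈-refl : ∀ {a} → a ≈ a
  ≈-refl = ≈-reflexive refl

  ≈-sym : ∀ {a b} → a ≈ b → b ≈ a
  ≈-sym {a} {b} a≈b = divides-via (identity a b) (ℤ∣.∣m⇒∣-m (divides a≈b))
    where
    identity : ∀ a b → - (a - b) ≡ b - a
    identity = solve-∀

  ≈-trans : ∀ {a b c} → a ≈ b → b ≈ c → a ≈ c
  ≈-trans {a} {b} {c} a≈b b≈c =
    divides-via (identity a b c) (ℤ∣.∣m∣n⇒∣m+n (divides a≈b) (divides b≈c))
    where
    identity : ∀ a b c → (a - b) + (b - c) ≡ a - c
    identity = solve-∀

  ≈-setoid : Setoid _ _
  ≈-setoid = record
    { Carrier       = ℤ
    ; _≈_           = _≈_
    ; isEquivalence = record { refl = ≈-refl ; sym = ≈-sym ; trans = ≈-trans }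
    }

  module ≈-Reasoning = Relation.Binary.Reasoning.Setoid ≈-setoid

  +-cong : ∀ {a b c d} → a ≈ b → c ≈ d → a + c ≈ b + d
  +-cong {a} {b} {c} {d} a≈b c≈d =
    divides-via (identity a b c d) (ℤ∣.∣m∣n⇒∣m+n (divides a≈b) (divides c≈d))
    where
    identity : ∀ a b c d → (a - b) + (c - d) ≡ (a + c) - (b + d)
    identity = solve-∀

  +-congˡ : ∀ a {b c} → b ≈ c → a + b ≈ a + c
  +-congˡ a = +-cong (≈-refl {a})

  -‿cong : ∀ {a b} → a ≈ b → - a ≈ - b
  -‿cong {a} {b} a≈b = divides-via (identity a b) (ℤ∣.∣m⇒∣-m (divides a≈b))
    where
    identity : ∀ a b → - (a - b) ≡ - a - - b
    identity = solve-∀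

  -cong : ∀ {a b c d} → a ≈ b → c ≈ d → a - c ≈ b - d
  -cong a≈b c≈d = +-cong a≈b (-‿cong c≈d)

  -congʳ : ∀ c {a b} → a ≈ b → a - c ≈ b - c
  -congʳ c a≈b = -cong a≈b (≈-refl {c})

  *-cong : ∀ {a b c d} → a ≈ b → c ≈ d → a * c ≈ b * d
  *-cong {a} {b} {c} {d} a≈b c≈d =
    divides-via (identity a b c d)
      (ℤ∣.∣m∣n⇒∣m+n (ℤ∣.∣n⇒∣m*n a (divides c≈d)) (ℤ∣.∣m⇒∣m*n d (divides a≈b)))
    where
    identity : ∀ a b c d → a * (c - d) + (a - b) * d ≡ a * c - b * d
    identity = solve-∀

  +-cancelˡ-≈ : ∀ c {a b} → c + a ≈ c + b → a ≈ b
  +-cancelˡ-≈ c {a} {b} c+a≈c+b = begin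
    a           ≡⟨ identity c a ⟩
    c + a - c   ≈⟨ -congʳ c c+a≈c+b ⟩
    c + b - c   ≡⟨ identity c b ⟨
    b           ∎
    where
    open ≈-Reasoning
    identity : ∀ c a → a ≡ c + a - c
    identity = solve-∀

  -≈0⇒≈ : ∀ {a b} → a - b ≈ 0ℤ → a ≈ b
  -≈0⇒≈ {a} {b} a-b≈0 = begin
    a           ≡⟨ identity a b ⟩
    (a - b) + b ≈⟨ +-cong a-b≈0 ≈-refl ⟩
    0ℤ + b      ≡⟨ ℤP.+-identityˡ b ⟩
    b           ∎
    where
    open ≈-Reasoning
    identity : ∀ a b → a ≡ (a - b) + b
    identity = solve-∀

  ≈⇒-≈0 : ∀ {a b} → a ≈ b → a - b ≈ 0ℤ
  ≈⇒-≈0 {b = b} a≈b = ≈-trans (-congʳ b a≈b) (≈-reflexive (ℤP.+-inverseʳ b))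

  *-congˡ : ∀ a {b c} → b ≈ c → a * b ≈ a * c
  *-congˡ a = *-cong (≈-refl {a})

  ≈0-*ʳ : ∀ {a} b → a ≈ 0ℤ → a * b ≈ 0ℤ
  ≈0-*ʳ b a≈0 = ≈-trans (*-cong a≈0 (≈-refl {b})) (≈-reflexive (ℤP.*-zeroˡ b))

  ≈0-*ˡ : ∀ a {b} → b ≈ 0ℤ → a * b ≈ 0ℤ
  ≈0-*ˡ a b≈0 = ≈-trans (*-congˡ a b≈0) (≈-reflexive (ℤP.*-zeroʳ a))

  ≈0⇒∣∣ : ∀ {a} → a ≈ 0ℤ → p ℕ∣.∣ ℤ.∣ a ∣
  ≈0⇒∣∣ {a} (mod a≡0) = subst (λ x → p ℕ∣.∣ ℤ.∣ x ∣) (ℤP.+-identityʳ a) a≡0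

  ∣∣⇒≈0 : ∀ {a} → p ℕ∣.∣ ℤ.∣ a ∣ → a ≈ 0ℤ
  ∣∣⇒≈0 {a} p∣a = mod (subst (λ x → p ℕ∣.∣ ℤ.∣ x ∣) (sym (ℤP.+-identityʳ a)) p∣a)

  ∣⇒+≈0 : ∀ {n} → p ℕ∣.∣ n → + n ≈ 0ℤ
  ∣⇒+≈0 = ∣∣⇒≈0

  sumTo-cong-≈ : ∀ {f g : ℕ → ℤ} n → (∀ i → i < n → f i ≈ g i) → sumTo f n ≈ sumTo g n
  sumTo-cong-≈ zero    f≈g = ≈-refl
  sumTo-cong-≈ (suc n) f≈g =
    +-cong (sumTo-cong-≈ n (λ i i<n → f≈g i (ℕP.m<n⇒m<1+n i<n))) (f≈g n ℕP.≤-refl)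

  sumTo-≈0 : ∀ {f : ℕ → ℤ} n → (∀ i → i < n → f i ≈ 0ℤ) → sumTo f n ≈ 0ℤ
  sumTo-≈0 n f≈0 = ≈-trans (sumTo-cong-≈ n f≈0) (≈-reflexive (sumTo-zero n))

  sumTo-single-≈ : ∀ (f : ℕ → ℤ) {a} m → a < m →
    (∀ i → i < m → i ≢ a → f i ≈ 0ℤ) → sumTo f m ≈ f a
  sumTo-single-≈ f (suc m) a<1+m others with ℕP.m<1+n⇒m<n∨m≡n a<1+m
  ... | inj₂ refl = ≈-trans (+-cong (sumTo-≈0 m λ i i<m → others′ i i<m (ℕP.<⇒≢ i<m)) ≈-refl)
                            (≈-reflexive (ℤP.+-identityˡ (f m)))
    where others′ = λ i i<m → others i (ℕP.m<n⇒m<1+n i<m)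
  ... | inj₁ a<m  = ≈-trans (+-cong (sumTo-single-≈ f m a<m others′)
                                    (others m ℕP.≤-refl (λ m≡a → ℕP.<⇒≢ a<m (sym m≡a))))
                            (≈-reflexive (ℤP.+-identityʳ (f _)))
    where others′ = λ i i<m → others i (ℕP.m<n⇒m<1+n i<m)

  infix 4 X^_∣_
  X^_∣_ : ℕ → Series → Set
  X^ a ∣ f = ∀ n → n < a → f n ≈ 0ℤ

  X^∣-*S : ∀ {a b f g} → X^ a ∣ f → X^ b ∣ g → X^ (a ℕ.+ b) ∣ (f *S g)
  X^∣-*S {a} {b} {f} {g} a∣f b∣g n n<a+b = sumTo-≈0 (suc n) term
    where
    term : ∀ i → i < suc n → f i * g (n ∸ i) ≈ 0ℤ
    term i (s≤s i≤n) with i <? a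
    ... | yes i<a = ≈0-*ʳ (g (n ∸ i)) (a∣f i i<a)
    ... | no  i≮a = ≈0-*ˡ (f i) (b∣g (n ∸ i) (∸-<-of-+ n<a+b (ℕP.≮⇒≥ i≮a) i≤n))

  *S-leading : ∀ {a b f g} → X^ a ∣ f → X^ b ∣ g → (f *S g) (a ℕ.+ b) ≈ f a * g b
  *S-leading {a} {b} {f} {g} a∣f b∣g =
    ≈-trans (sumTo-single-≈ _ (suc (a ℕ.+ b)) (s≤s (ℕP.m≤m+n a b)) term)
            (≈-reflexive (cong (λ j → f a * g j) (ℕP.m+n∸m≡n a b)))
    where
    term : ∀ i → i < suc (a ℕ.+ b) → i ≢ a → f i * g (a ℕ.+ b ∸ i) ≈ 0ℤ
    term i (s≤s i≤a+b) i≢a with i <? a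
    ... | yes i<a = ≈0-*ʳ (g (a ℕ.+ b ∸ i)) (a∣f i i<a)
    ... | no  i≮a = ≈0-*ˡ (f i) (b∣g (a ℕ.+ b ∸ i)
                      (∸-<-of-+ ℕP.≤-refl (ℕP.≤∧≢⇒< (ℕP.≮⇒≥ i≮a) (i≢a ∘ sym)) i≤a+b))

  X^∣-powS : ∀ {a f} → X^ a ∣ f → ∀ k → X^ (k ℕ.* a) ∣ powS f k
  X^∣-powS a∣f zero    n ()
  X^∣-powS a∣f (suc k) = X^∣-*S a∣f (X^∣-powS a∣f k)

  powS-leading : ∀ {f} → X^ 1 ∣ f → ∀ k → powS f k k ≈ f 1 ^ k
  powS-leading     X∣f zero    = ≈-refl
  powS-leading {f} X∣f (suc k) =
    ≈-trans (*S-leading X∣f (subst (X^_∣ powS f k) (ℕP.*-identityʳ k) (X^∣-powS X∣f k)))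
            (*-congˡ (f 1) (powS-leading X∣f k))

module PrimeModulus {q : ℕ} (p-prime : Prime (suc q)) where

  open Congruence (suc q)

  ≈0-*⇒ : ∀ {a b} → a * b ≈ 0ℤ → a ≈ 0ℤ ⊎ b ≈ 0ℤ
  ≈0-*⇒ {a} {b} ab≈0
    with euclidsLemma ℤ.∣ a ∣ ℤ.∣ b ∣ p-prime (subst (suc q ℕ∣.∣_) (ℤP.abs-* a b) (≈0⇒∣∣ ab≈0))
  ... | inj₁ p∣a = inj₁ (∣∣⇒≈0 p∣a)
  ... | inj₂ p∣b = inj₂ (∣∣⇒≈0 p∣b)

  *-cancelˡ-≈ : ∀ {a b c} → ¬ a ≈ 0ℤ → a * b ≈ a * c → b ≈ c
  *-cancelˡ-≈ {a} {b} {c} a≉0 ab≈ac = [ flip contradiction a≉0 , -≈0⇒≈ ] (≈0-*⇒ a[b-c]≈0)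
    where
    identity : ∀ a b c → a * (b - c) ≡ a * b - a * c
    identity = solve-∀
    a[b-c]≈0 : a * (b - c) ≈ 0ℤ
    a[b-c]≈0 = ≈-trans (≈-reflexive (identity a b c)) (≈⇒-≈0 ab≈ac)

  sumTo-pC[1+j]*F≈F[p-1] : ∀ (F : ℕ → ℤ) → sumTo (λ j → + (suc q C suc j) * F j) (suc q) ≈ F q
  sumTo-pC[1+j]*F≈F[p-1] F =
    ≈-trans (sumTo-single-≈ (λ j → + (suc q C suc j) * F j) (suc q) ℕP.≤-refl term)
            (≈-reflexive (trans (cong (λ c → + c * F q) (nCn≡1 (suc q))) (ℤP.*-identityˡ (F q))))
    where
    term : ∀ j → j < suc q → j ≢ q → + (suc q C suc j) * F j ≈ 0ℤ
    term j (s≤s j≤q) j≢q =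
      ≈0-*ʳ (F j) (∣⇒+≈0 (prime∣pCk p-prime (s≤s z≤n) (s≤s (ℕP.≤∧≢⇒< j≤q j≢q))))

  £₀≈[g-1]^[p-1]-1 : ∀ g n → £₀ (suc q) g n ≈ powS (g -1S) q n - oneS n
  £₀≈[g-1]^[p-1]-1 g n = begin
    £₀ (suc q) g n
      ≡⟨ identity (£₀ (suc q) g n) (oneS n) ⟩
    (£₀ (suc q) g n + oneS n) - oneS n
      ≡⟨ cong (_- oneS n) (sumTo-powS-binomial g q n) ⟩
    sumTo (λ j → + (suc q C suc j) * powS (g -1S) j n) (suc q) - oneS n
      ≈⟨ -congʳ (oneS n) (sumTo-pC[1+j]*F≈F[p-1] (λ j → powS (g -1S) j n)) ⟩
    powS (g -1S) q n - oneS n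
      ∎
    where
    open ≈-Reasoning
    identity : ∀ a b → a ≡ (a + b) - b
    identity = solve-∀

  freshman's-dream : ∀ x → (1ℤ + x) ^ suc q ≈ 1ℤ + x ^ suc q
  freshman's-dream x = begin
    (1ℤ + x) ^ suc q
      ≡⟨ binomial-ℤ x (suc q) ⟩
    sumTo (λ j → + (suc q C j) * x ^ j) (suc (suc q))
      ≡⟨ sumTo-unfoldˡ (λ j → + (suc q C j) * x ^ j) (suc q) ⟩
    1ℤ * 1ℤ + sumTo (λ j → + (suc q C suc j) * x ^ suc j) (suc q)
      ≈⟨ +-congˡ 1ℤ (sumTo-pC[1+j]*F≈F[p-1] (λ j → x ^ suc j)) ⟩
    1ℤ + x ^ suc q
      ∎
    where open ≈-Reasoning

  private
    stepUp : ∀ a → a ^ suc q ≈ a → (1ℤ + a) ^ suc q ≈ 1ℤ + a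
    stepUp a a^p≈a = ≈-trans (freshman's-dream a) (+-congˡ 1ℤ a^p≈a)

    stepDown : ∀ a → (1ℤ + a) ^ suc q ≈ 1ℤ + a → a ^ suc q ≈ a
    stepDown a [1+a]^p≈1+a = +-cancelˡ-≈ 1ℤ (≈-trans (≈-sym (freshman's-dream a)) [1+a]^p≈1+a)

  -- Induction in both directions from 0; note that 1ℤ + -[1+ suc n ] reduces to -[1+ n ].
  x^p≈x : ∀ a → a ^ suc q ≈ a
  x^p≈x (+ zero)       = ≈-reflexive (ℤP.*-zeroˡ (0ℤ ^ q))
  x^p≈x (+ suc n)      = stepUp (+ n) (x^p≈x (+ n))
  x^p≈x -[1+ zero ]    = stepDown -[1+ zero ] (x^p≈x (+ zero))
  x^p≈x -[1+ suc n ]   = stepDown -[1+ suc n ] (x^p≈x -[1+ n ])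

  x^[p-1]≈1 : ∀ {a} → ¬ a ≈ 0ℤ → a ^ q ≈ 1ℤ
  x^[p-1]≈1 {a} a≉0 = *-cancelˡ-≈ a≉0 (≈-trans (x^p≈x a) (≈-reflexive (sym (ℤP.*-identityʳ a))))

  X^1∣g-1 : ∀ g → g 0 ≈ 1ℤ → X^ 1 ∣ (g -1S)
  X^1∣g-1 g g₀≈1 zero    _ = ≈⇒-≈0 g₀≈1
  X^1∣g-1 g g₀≈1 (suc n) (s≤s ())

  X^2∣g-1 : ∀ g → g 0 ≈ 1ℤ → g 1 ≈ 0ℤ → X^ 2 ∣ (g -1S)
  X^2∣g-1 g g₀≈1 g₁≈0 zero          _ = ≈⇒-≈0 g₀≈1
  X^2∣g-1 g g₀≈1 g₁≈0 (suc zero)    _ = ≈-trans (≈-reflexive (ℤP.+-identityʳ (g 1))) g₁≈0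
  X^2∣g-1 g g₀≈1 g₁≈0 (suc (suc n)) (s≤s (s≤s ()))

  powS-≈-X^[p-1] : ∀ {h} → X^ 1 ∣ h → ¬ h 1 ≈ 0ℤ → ∀ n → n < suc q →
    powS h q n ≈ (if n ≡ᵇ q then 1ℤ else 0ℤ)
  powS-≈-X^[p-1] X∣h h₁≉0 n (s≤s n≤q) with n ≡ᵇ q in n≡ᵇq
  ... | true rewrite ℕP.≡ᵇ⇒≡ n q (subst T (sym n≡ᵇq) tt) =
    ≈-trans (powS-leading X∣h q) (x^[p-1]≈1 h₁≉0)
  ... | false = X^∣-powS X∣h q n (subst (n <_) (sym (ℕP.*-identityʳ q)) (ℕP.≤∧≢⇒< n≤q n≢q))
    where
    n≢q : n ≢ q
    n≢q n≡q = subst T n≡ᵇq (ℕP.≡⇒≡ᵇ n q n≡q)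

  £₀≈X^[p-1]-1 : ∀ g → g 0 ≈ 1ℤ → ¬ g 1 ≈ 0ℤ → ∀ n → n < suc q →
    £₀ (suc q) g n ≈ XpowMinusOne (suc q) n
  £₀≈X^[p-1]-1 g g₀≈1 g₁≉0 n n<p =
    ≈-trans (£₀≈[g-1]^[p-1]-1 g n)
            (-congʳ (oneS n) (powS-≈-X^[p-1] (X^1∣g-1 g g₀≈1) h₁≉0 n n<p))
    where
    h₁≉0 : ¬ (g -1S) 1 ≈ 0ℤ
    h₁≉0 h₁≈0 = g₁≉0 (≈-trans (≈-reflexive (sym (ℤP.+-identityʳ (g 1)))) h₁≈0)

  £₀≈-1 : ∀ g → g 0 ≈ 1ℤ → g 1 ≈ 0ℤ → ∀ n → n < q ℕ.* 2 → £₀ (suc q) g n ≈ minusOne n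
  £₀≈-1 g g₀≈1 g₁≈0 n n<2q =
    ≈-trans (£₀≈[g-1]^[p-1]-1 g n)
      (≈-trans (-congʳ (oneS n) (X^∣-powS (X^2∣g-1 g g₀≈1 g₁≈0) q n n<2q))
               (≈-reflexive (ℤP.+-identityˡ (minusOne n))))

lemma5 : (p : ℕ) → Prime p → (g : Series) → g 0 ≡ + 1 [mod p ] →
    ((¬ (g 1 ≡ + 0 [mod p ]) → £₀ p g ≡ XpowMinusOne p [modp p ,X^ p ])
    × (g 1 ≡ + 0 [mod p ] → £₀ p g ≡ minusOne [modp p ,X^ (2 ℕ.* p ∸ 2) ]))
lemma5 zero    p-prime = contradiction p-prime ¬prime[0]
lemma5 (suc q) p-prime g g₀≡1 =
    (λ g₁≢0 n n<p → unmod (£₀≈X^[p-1]-1 g (mod g₀≡1) (g₁≢0 ∘ unmod) n n<p))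
  , (λ g₁≡0 n n<2p-2 → unmod (£₀≈-1 g (mod g₀≡1) (mod g₁≡0) n (subst (n <_) 2p-2≡2q n<2p-2)))
  where
  open PrimeModulus p-prime
  open Congruence (suc q)
  2p-2≡2q : 2 ℕ.* suc q ∸ 2 ≡ q ℕ.* 2
  2p-2≡2q = trans (sym (ℕP.*-distribˡ-∸ 2 (suc q) 1)) (ℕP.*-comm 2 q)
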